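{- Let $\hat{\mathcal{P}}$ be a finite protocol instance, $\mathsf{s}$ one of its sorts, and $\varphi$ a quantifier-free clause such that $0<\#(\varphi,\mathsf{s})<|\mathsf{s}|$. Let $c_1,\dots,c_n$ ($n=\#(\varphi,\mathsf{s})$) be the distinct constants of $\mathsf{s}$ occurring in $\varphi$, let $\widehat{\varphi}$ be obtained from $\varphi$ by replacing each $c_i$ by a variable $V_i$ of sort $\mathsf{s}$, and let $$\Phi(\mathsf{s})=\forall V_1,\dots,V_n\in\mathsf{s}:\ (\mathrm{distinct}\ V_1\dots V_n)\to\widehat{\varphi}.$$ Then $\Phi(\mathsf{s})$ is logically equivalent to $\varphi^{L(Sym(\mathsf{s}))}=\bigwedge_{\gamma\in Sym(\mathsf{s})}\varphi^{\gamma}$.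
   Context: A finite protocol instance has finitely many sorts, each a finite set of distinct constants; state variables are Boolean variables $r(c_1,\dots,c_k)$ obtained by instantiating protocol relations with sort constants, and a clause is a disjunction of literals over them. $Sym(\mathsf{s})$ is the symmetric group on the constants of sort $\mathsf{s}$; for $\gamma\in Sym(\mathsf{s})$, $\varphi^{\gamma}$ is obtained by replacing each constant $c$ of $\mathsf{s}$ in $\varphi$ by $\gamma(c)$. $\#(\varphi,\mathsf{s})$ denotes the number of distinct constants of sort $\mathsf{s}$ that occur in $\varphi$, and $|\mathsf{s}|$ is the number of constants of $\mathsf{s}$. $(\mathrm{distinct}\ V_1\dots V_n)$ asserts that the $V_i$ take pairwise different values. -}

module Defs where

open import Data.Nat using (ℕ; _<_)
open import Data.Fin as Fin using (Fin)
open import Data.Fin.Permutation using (Permutation′; _⟨$⟩ʳ_)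
open import Data.Bool using (Bool; true; false; not; if_then_else_)
open import Data.List as List using (List; []; _∷_; length; deduplicate; concatMap)
open import Data.List.Relation.Unary.All as All using (All; []; _∷_)
open import Data.List.Relation.Unary.Any using (Any)
open import Data.List.Membership.Propositional using () renaming (_∈_ to _∈ₗ_)
open import Data.Vec as Vec using (Vec; []; _∷_)
open import Data.Vec.Membership.Propositional using () renaming (_∈_ to _∈ᵥ_)
open import Data.Maybe using (Maybe; just; nothing)
open import Data.Sum using (_⊎_; inj₁; inj₂)
open import Data.Product using (_×_; _,_)
open import Relation.Binary.PropositionalEquality using (_≡_; _≢_; refl)
open import Relation.Nullary using (yes; no)
open import Function.Bundles using (_⇔_)

-- A finite protocol instance: finitely many sorts, each a finite set of
-- constants (sort t has constants Fin (size t)), and finitely many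
-- relations, each with an arity given as a list of sorts.

record Protocol : Set where
  field
    nSorts : ℕ
    size   : Fin nSorts → ℕ
    nRels  : ℕ
    arity  : Fin nRels → List (Fin nSorts)

module _ (P : Protocol) where
  open Protocol P

  Sort : Set
  Sort = Fin nSorts

  Const : Sort → Set
  Const t = Fin (size t)

  card : Sort → ℕ
  card t = size t

  record AtomOver (T : Sort → Set) : Set where
    constructor atom
    field
      rel  : Fin nRels
      args : All T (arity rel)

  record LitOver (T : Sort → Set) : Set where
    constructor lit
    field
      pos : Bool
      at  : AtomOver T

  ClauseOver : (Sort → Set) → Set
  ClauseOver T = List (LitOver T)

  mapClause : {T U : Sort → Set} → (∀ {t} → T t → U t) → ClauseOver T → ClauseOver U
  mapClause f = List.map (λ { (lit b (atom r as)) → lit b (atom r (All.map f as)) })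

  StateVar : Set
  StateVar = AtomOver Const

  Clause : Set
  Clause = ClauseOver Const

  State : Set
  State = StateVar → Bool

  evalLit : State → LitOver Const → Bool
  evalLit st (lit b a) = if b then st a else not (st a)

  _⊨_ : State → Clause → Set
  st ⊨ φ = Any (λ l → evalLit st l ≡ true) φ

  module _ (s : Sort) where

    constOfSort : ∀ {t} → Const t → List (Const s)
    constOfSort {t} c with t Fin.≟ s
    ... | yes refl = c ∷ []
    ... | no _     = []

    argsConsts : ∀ {ts} → All Const ts → List (Const s)
    argsConsts []       = []
    argsConsts (c ∷ as) = constOfSort c List.++ argsConsts as

    constsOf : Clause → List (Const s)
    constsOf = concatMap (λ { (lit _ (atom _ as)) → argsConsts as })

    #[_,s] : Clause → ℕ
    #[ φ ,s] = length (deduplicate Fin._≟_ (constsOf φ))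

    renameConst : (Const s → Const s) → ∀ {t} → Const t → Const t
    renameConst γ {t} c with t Fin.≟ s
    ... | yes refl = γ c
    ... | no _     = c

    _^_ : Clause → Permutation′ (size s) → Clause
    φ ^ γ = mapClause (renameConst (γ ⟨$⟩ʳ_)) φ

    ⟦⋀Sym⟧ : Clause → State → Set
    ⟦⋀Sym⟧ φ st = (γ : Permutation′ (size s)) → st ⊨ (φ ^ γ)

    -- open clauses: arguments of sort s may be variables V₁,…,Vₙ

    OpenTerm : ℕ → Sort → Set
    OpenTerm n t = Const t ⊎ (t ≡ s × Fin n)

    OpenClause : ℕ → Set
    OpenClause n = ClauseOver (OpenTerm n)

    indexOf : ∀ {n} → Vec (Const s) n → Const s → Maybe (Fin n)
    indexOf []       c = nothing
    indexOf (d ∷ ds) c with d Fin.≟ c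
    ... | yes _ = just Fin.zero
    ... | no _  with indexOf ds c
    ...   | just i  = just (Fin.suc i)
    ...   | nothing = nothing

    abstractConst : ∀ {n} → Vec (Const s) n → ∀ {t} → Const t → OpenTerm n t
    abstractConst cs {t} c with t Fin.≟ s
    ... | no _ = inj₁ c
    ... | yes refl with indexOf cs c
    ...   | just i  = inj₂ (refl , i)
    ...   | nothing = inj₁ c

    hat : ∀ {n} → Vec (Const s) n → Clause → OpenClause n
    hat cs = mapClause (abstractConst cs)

    instTerm : ∀ {n} → (Fin n → Const s) → ∀ {t} → OpenTerm n t → Const t
    instTerm V (inj₁ c)          = c
    instTerm V (inj₂ (refl , i)) = V i

    inst : ∀ {n} → (Fin n → Const s) → OpenClause n → Clause
    inst V = mapClause (instTerm V)

    Distinct : ∀ {n} → (Fin n → Const s) → Set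
    Distinct {n} V = (i j : Fin n) → i ≢ j → V i ≢ V j

    ⟦∀distinct⟧ : ∀ {n} → OpenClause n → State → Set
    ⟦∀distinct⟧ {n} ψ st = (V : Fin n → Const s) → Distinct V → st ⊨ inst V ψ

    ⟦Φ⟧ : ∀ {n} → Vec (Const s) n → Clause → State → Set
    ⟦Φ⟧ cs φ = ⟦∀distinct⟧ (hat cs φ)

    Enumerates : ∀ {n} → Vec (Const s) n → Clause → Set
    Enumerates {n} cs φ =
      ((i j : Fin n) → i ≢ j → Vec.lookup cs i ≢ Vec.lookup cs j) ×
      ((c : Const s) → (c ∈ₗ constsOf φ) ⇔ (c ∈ᵥ cs))

-- Φ(s) and ⋀_γ φ^γ are conjunctions over two families of instances of φ̂, and these
-- families coincide: instantiating V₁,…,Vₙ by distinct constants gives exactly the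
-- clauses φ^γ, since a permutation γ yields the distinct values γ(c₁),…,γ(cₙ), and
-- conversely any two injective n-tuples of constants of s are related by a
-- permutation of s (built from n transpositions).
module Submission where

open import Defs
open import Data.Nat using (_<_; zero; suc)
open import Data.Fin as Fin using (Fin; zero; suc)
open import Data.Fin.Properties using (suc-injective)
open import Data.Fin.Permutation using (Permutation′; _⟨$⟩ʳ_; _∘ₚ_; transpose; id)
import Data.Fin.Permutation.Components as Components
open import Data.List using (_∷_; [])
open import Data.List.Relation.Unary.All as All using (All; []; _∷_)
open import Data.List.Relation.Unary.All.Properties using (++⁻ˡ; ++⁻ʳ)
open import Data.Vec as Vec using (Vec; _∷_)
open import Data.Vec.Relation.Unary.Any using (here; there)
open import Data.Vec.Membership.Propositional using () renaming (_∈_ to _∈ᵥ_)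
open import Data.Maybe using (just; nothing)
open import Data.Product using (_,_; ∃; proj₁; proj₂)
open import Data.Empty using (⊥-elim)
open import Function.Base using (_∘′_)
open import Function.Bundles using (_⇔_; mk⇔; Equivalence; Injection)
open import Function.Properties.Inverse using (↔⇒↣)
open import Relation.Binary.PropositionalEquality
open import Relation.Nullary using (yes; no)

AllDistinct : ∀ {a} {A : Set a} {n} → (Fin n → A) → Set a
AllDistinct {n = n} f = (i j : Fin n) → i ≢ j → f i ≢ f j

AllDistinct-tail : ∀ {a} {A : Set a} {n} {f : Fin (suc n) → A} →
                   AllDistinct f → AllDistinct (λ i → f (suc i))
AllDistinct-tail f-distinct i j i≢j = f-distinct _ _ (i≢j ∘′ suc-injective)

transpose-mapsˡ : ∀ {m} (i j : Fin m) → Components.transpose i j i ≡ j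
transpose-mapsˡ i j with i Fin.≟ i
... | yes _   = refl
... | no i≢i = ⊥-elim (i≢i refl)

transpose-fixes : ∀ {m} (i j k : Fin m) → k ≢ i → k ≢ j → Components.transpose i j k ≡ k
transpose-fixes i j k k≢i k≢j with k Fin.≟ i
... | yes k≡i = ⊥-elim (k≢i k≡i)
... | no _ with k Fin.≟ j
...   | yes k≡j = ⊥-elim (k≢j k≡j)
...   | no _    = refl

permutation-injective : ∀ {m} (γ : Permutation′ m) {x y} → γ ⟨$⟩ʳ x ≡ γ ⟨$⟩ʳ y → x ≡ y
permutation-injective γ = Injection.injective (↔⇒↣ γ)

-- Induction on n: γ′ carries a(1..n) to b(1..n); then the transposition of γ′(a 0)
-- and b 0 fixes every b i with i > 0, because γ′(a 0) is none of them.
permutation-between : ∀ {m} n (a b : Fin n → Fin m) → AllDistinct a → AllDistinct b →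
                      ∃ λ (γ : Permutation′ m) → ∀ i → γ ⟨$⟩ʳ a i ≡ b i
permutation-between zero    a b _ _ = id , λ ()
permutation-between (suc n) a b a-distinct b-distinct = γ′ ∘ₚ transpose a₀′ b₀ , maps
  where
  tail-permutation = permutation-between n (λ i → a (suc i)) (λ i → b (suc i))
                       (AllDistinct-tail a-distinct) (AllDistinct-tail b-distinct)
  γ′   = proj₁ tail-permutation
  γ′-maps = proj₂ tail-permutation
  a₀′ = γ′ ⟨$⟩ʳ a zero
  b₀  = b zero

  a₀′≢b : ∀ i → b (suc i) ≢ a₀′
  a₀′≢b i bᵢ≡a₀′ = a-distinct (suc i) zero (λ ())
    (permutation-injective γ′ (trans (γ′-maps i) bᵢ≡a₀′))

  maps : ∀ i → Components.transpose a₀′ b₀ (γ′ ⟨$⟩ʳ a i) ≡ b i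
  maps zero    = transpose-mapsˡ a₀′ b₀
  maps (suc i) = begin
    Components.transpose a₀′ b₀ (γ′ ⟨$⟩ʳ a (suc i)) ≡⟨ cong (Components.transpose a₀′ b₀) (γ′-maps i) ⟩
    Components.transpose a₀′ b₀ (b (suc i))         ≡⟨ transpose-fixes a₀′ b₀ _ (a₀′≢b i) (b-distinct (suc i) zero (λ ())) ⟩
    b (suc i)                                       ∎
    where open ≡-Reasoning

module _ (P : Protocol) (s : Sort P) where

  indexOf-sound : ∀ {n} (cs : Vec (Const P s) n) c {i} →
                  indexOf P s cs c ≡ just i → Vec.lookup cs i ≡ c
  indexOf-sound (d ∷ ds) c eq with d Fin.≟ c
  indexOf-sound (d ∷ ds) c refl | yes d≡c = d≡c
  ... | no _ with indexOf P s ds c in eq′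
  indexOf-sound (d ∷ ds) c refl | no _ | just j = indexOf-sound ds c eq′

  indexOf-complete : ∀ {n} (cs : Vec (Const P s) n) c → c ∈ᵥ cs → indexOf P s cs c ≢ nothing
  indexOf-complete (d ∷ ds) c c∈cs with d Fin.≟ c
  ... | yes _ = λ ()
  ... | no d≢c with c∈cs
  ...   | here c≡d = ⊥-elim (d≢c (sym c≡d))
  ...   | there c∈ds with indexOf P s ds c | indexOf-complete ds c c∈ds
  ...     | just _  | _            = λ ()
  ...     | nothing | not-nothing = ⊥-elim (not-nothing refl)

  module _ {n} (cs : Vec (Const P s) n) (γ : Const P s → Const P s) (V : Fin n → Const P s)
           (γ-maps : ∀ i → γ (Vec.lookup cs i) ≡ V i) where

    instTerm-abstractConst : ∀ {t} (c : Const P t) → All (_∈ᵥ cs) (constOfSort P s c) →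
      instTerm P s V (abstractConst P s cs c) ≡ renameConst P s γ c
    instTerm-abstractConst {t} c c∈cs with t Fin.≟ s
    ... | no _ = refl
    ... | yes refl with indexOf P s cs c in eq
    ...   | just i  = trans (sym (γ-maps i)) (cong γ (indexOf-sound cs c eq))
    ...   | nothing = ⊥-elim (indexOf-complete cs c (All.head c∈cs) eq)

    instArgs-abstractArgs : ∀ {ts} (as : All (Const P) ts) → All (_∈ᵥ cs) (argsConsts P s as) →
      All.map (instTerm P s V) (All.map (abstractConst P s cs) as) ≡ All.map (renameConst P s γ) as
    instArgs-abstractArgs []       _       = refl
    instArgs-abstractArgs (c ∷ as) as∈cs = cong₂ _∷_
      (instTerm-abstractConst c (++⁻ˡ (constOfSort P s c) as∈cs))
      (instArgs-abstractArgs as (++⁻ʳ (constOfSort P s c) as∈cs))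

    inst-hat : (φ : Clause P) → All (_∈ᵥ cs) (constsOf P s φ) →
               inst P s V (hat P s cs φ) ≡ mapClause P (renameConst P s γ) φ
    inst-hat []                      _      = refl
    inst-hat (lit b (atom r as) ∷ φ) φ∈cs = cong₂ _∷_
      (cong (lit b ∘′ atom r) (instArgs-abstractArgs as (++⁻ˡ (argsConsts P s as) φ∈cs)))
      (inst-hat φ (++⁻ʳ (argsConsts P s as) φ∈cs))

theorem2 : (P : Protocol) (s : Sort P) (φ : Clause P)
    → 0 < #[_,s] P s φ → #[_,s] P s φ < card P s
    → (cs : Vec (Const P s) (#[_,s] P s φ)) → Enumerates P s cs φ
    → (st : State P) → ⟦Φ⟧ P s cs φ st ⇔ ⟦⋀Sym⟧ P s φ st
theorem2 P s φ _ _ cs (cs-distinct , cs-enumerates) st = mk⇔ Φ⇒⋀Sym ⋀Sym⇒Φ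
  where
  φ⊆cs : All (_∈ᵥ cs) (constsOf P s φ)
  φ⊆cs = All.tabulate (Equivalence.to (cs-enumerates _))

  Φ⇒⋀Sym : ⟦Φ⟧ P s cs φ st → ⟦⋀Sym⟧ P s φ st
  Φ⇒⋀Sym Φ γ = subst (_⊨_ P st) (inst-hat P s cs (γ ⟨$⟩ʳ_) V (λ _ → refl) φ φ⊆cs) (Φ V V-distinct)
    where
    V = λ i → γ ⟨$⟩ʳ Vec.lookup cs i
    V-distinct : Distinct P s V
    V-distinct i j i≢j = cs-distinct i j i≢j ∘′ permutation-injective γ

  ⋀Sym⇒Φ : ⟦⋀Sym⟧ P s φ st → ⟦Φ⟧ P s cs φ st
  ⋀Sym⇒Φ ⋀Sym V V-distinct with permutation-between _ (Vec.lookup cs) V cs-distinct V-distinct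
  ... | γ , γ-maps = subst (_⊨_ P st) (sym (inst-hat P s cs (γ ⟨$⟩ʳ_) V γ-maps φ φ⊆cs)) (⋀Sym γ)
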